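{- For any monoid $M$, the clone $\mathsf{Pill}_{1,1}(M)=\mathbf{P}(M)/_\equiv$ admits the presentation $(\mathcal{G}_M,\mathcal{R}'_M)$, where $\mathcal{R}'_M$ is the equivalence relation on $\mathbf{T}(\mathcal{G}_M)$ generated by $\mathcal{R}_M$ together with the equations $\mathrm{rc}_M(1^{\alpha_1}1^{\alpha_2}2^e3^e1^{\alpha_3})\sim\mathrm{rc}_M(1^{\alpha_1}2^e1^{\alpha_2}3^e1^{\alpha_3})\sim\mathrm{rc}_M(1^{\alpha_1}2^e3^e1^{\alpha_2}1^{\alpha_3})$ (in arity $3$) and $\mathrm{rc}_M(1^{\alpha_1}2^e3^{\beta_1}1^{\alpha_2}4^e3^{\beta_2})\sim\mathrm{rc}_M(1^{\alpha_1}2^e1^{\alpha_2}3^{\beta_1}4^e3^{\beta_2})$ (in arity $4$), for all $\alpha_1,\alpha_2,\alpha_3,\beta_1,\beta_2\in M$, where $e$ is the unit of $M$.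
   Context: Clones: a clone $C$ is a graded set with superposition maps $C(n)\times C(m)^n\to C(m)$, $x[y_1,\dots,y_n]$, and projections $\mathbf{1}_{i,n}$ satisfying $\mathbf{1}_{i,n}[y_1,\dots,y_n]=y_i$, $x[\mathbf{1}_{1,n},\dots,\mathbf{1}_{n,n}]=x$ and $x[y_1,\dots,y_n][z_1,\dots,z_m]=x[y_1[z_1,\dots,z_m],\dots,y_n[z_1,\dots,z_m]]$; clone congruences are arity-preserving equivalence relations compatible with superposition. Let $(M,\cdot,e)$ be a monoid. $M$-pigmented letters are pairs $i^\alpha$ ($i\ge1$, $\alpha\in M$); $\mathbf{P}(M)(n)$ is the set of words of such letters with values in $[n]$. With $\alpha\odot i_1^{\alpha_1}\cdots i_\ell^{\alpha_\ell}:=i_1^{\alpha\alpha_1}\cdots i_\ell^{\alpha\alpha_\ell}$, $\mathbf{P}(M)$ is the clone with $i_1^{\alpha_1}\cdots i_\ell^{\alpha_\ell}[\mathfrak{p}_1,\dots,\mathfrak{p}_n]:=(\alpha_1\odot\mathfrak{p}_{i_1})\cdots(\alpha_\ell\odot\mathfrak{p}_{i_\ell})$ and projections $i^e$. A position $j$ of a word is a left (resp. right) $1$-witness if no earlier (resp. later) letter has the same value; $\mathrm{first}_1(\mathfrak{p})$ (resp. $\mathrm{first}_1^R(\mathfrak{p})$) is the subword of letters at left (resp. right) $1$-witness positions. $\equiv$: $\mathfrak{p}\equiv\mathfrak{p}'$ iff same arity, same multiset of pigmented letters, $\mathrm{first}_1(\mathfrak{p})=\mathrm{first}_1(\mathfrak{p}')$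 and $\mathrm{first}_1^R(\mathfrak{p})=\mathrm{first}_1^R(\mathfrak{p}')$; it is a clone congruence and $\mathsf{Pill}_{1,1}(M):=\mathbf{P}(M)/_\equiv$. Terms: $\mathbf{T}(\mathcal{G})(n)$ is the set of $\mathcal{G}$-terms with variables among $x_1,\dots,x_n$ (free clone: superposition = substitution, projections $x_i$). For $(\mathcal{G},\mathcal{R})$, $\equiv_{\mathcal{R}}$ is the smallest clone congruence containing $\mathcal{R}$; $(\mathcal{G},\mathcal{R})$ is a presentation of $C$ if $C\cong\mathbf{T}(\mathcal{G})/_{\equiv_{\mathcal{R}}}$. $\mathcal{G}_M(0)=\{\mathsf{u}\}$, $\mathcal{G}_M(1)=\{\mathsf{p}_\alpha:\alpha\in M\}$, $\mathcal{G}_M(2)=\{\star\}$; $\mathcal{R}_M$ is generated by $\star[\star[x_1,x_2],x_3]\sim\star[x_1,\star[x_2,x_3]]$, $\star[\mathsf{u},x_1]\sim x_1\sim\star[x_1,\mathsf{u}]$, $\mathsf{p}_\alpha[\star[x_1,x_2]]\sim\star[\mathsf{p}_\alpha[x_1],\mathsf{p}_\alpha[x_2]]$, $\mathsf{p}_\alpha[\mathsf{u}]\sim\mathsf{u}$, $\mathsf{p}_{\alpha_1}[\mathsf{p}_{\alpha_2}[x_1]]\sim\mathsf{p}_{\alpha_1\alpha_2}[x_1]$, $\mathsf{p}_e[x_1]\sim x_1$. Right comb map: $\mathrm{rc}_M(\epsilon)=\mathsf{u}$, $\mathrm{rc}_M(i^\alpha\mathfrak{p}')=\star[\mathsf{p}_\alpha[x_i],\mathrm{rc}_M(\mathfrak{p}')]$.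 -}

module Defs where

open import Level using (Level)
open import Data.Nat using (ℕ; zero; suc)
open import Data.Fin using (Fin; zero; suc)
import Data.Fin as Fin
open import Data.Product using (_×_; _,_; proj₁; proj₂; Σ; ∃)
open import Data.List using (List; []; _∷_; map; concatMap; reverse)
open import Data.List.Relation.Unary.Any using (any?)
open import Data.List.Relation.Binary.Permutation.Propositional using (_↭_)
open import Relation.Nullary using (yes; no)
open import Relation.Binary.PropositionalEquality using (_≡_)
open import Algebra.Core using (Op₂)

-- M-pigmented words:  P(M)(n) = words of letters i^α, i ∈ [n] (Fin n), α ∈ A

Letter : ∀ {c} → Set c → ℕ → Set c
Letter A n = Fin n × A

Word : ∀ {c} → Set c → ℕ → Set c
Word A n = List (Letter A n)

module _ {c} {A : Set c} where

  _⊙_[_] : Op₂ A → A → ∀ {n} → Word A n → Word A n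
  (_∙_ ⊙ α [ w ]) = map (λ l → proj₁ l , (α ∙ proj₂ l)) w

  wsup : Op₂ A → ∀ {n m} → Word A n → (Fin n → Word A m) → Word A m
  wsup _∙_ w ps = concatMap (λ l → _∙_ ⊙ proj₂ l [ ps (proj₁ l) ]) w

  first1-from : ∀ {n} → List (Fin n) → Word A n → Word A n
  first1-from seen [] = []
  first1-from seen (l ∷ w) with any? (λ j → proj₁ l Fin.≟ j) seen
  ... | yes _ = first1-from seen w
  ... | no  _ = l ∷ first1-from (proj₁ l ∷ seen) w

  first1 : ∀ {n} → Word A n → Word A n
  first1 = first1-from []

  first1R : ∀ {n} → Word A n → Word A n
  first1R w = reverse (first1 (reverse w))

  -- the congruence ≡ defining Pill_{1,1}(M) (arity is fixed by the type)
  PillEq : ∀ {n} → Word A n → Word A n → Set c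
  PillEq p p' = (p ↭ p') × (first1 p ≡ first1 p') × (first1R p ≡ first1R p')

data Term {c} (A : Set c) (n : ℕ) : Set c where
  var  : Fin n → Term A n
  u    : Term A n
  p    : A → Term A n → Term A n
  star : Term A n → Term A n → Term A n

module _ {c} {A : Set c} where

  _⟦_⟧ : ∀ {k n} → Term A k → (Fin k → Term A n) → Term A n
  var i ⟦ σ ⟧ = σ i
  u ⟦ σ ⟧ = u
  p α t ⟦ σ ⟧ = p α (t ⟦ σ ⟧)
  star t s ⟦ σ ⟧ = star (t ⟦ σ ⟧) (s ⟦ σ ⟧)

  rc : ∀ {n} → Word A n → Term A n
  rc [] = u
  rc ((i , α) ∷ w) = star (p α (var i)) (rc w)

data CloneCong {c r} {A : Set c} (R : ∀ n → Term A n → Term A n → Set r)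
       : ∀ n → Term A n → Term A n → Set (c Level.⊔ r) where
  ax    : ∀ {n t t'} → R n t t' → CloneCong R n t t'
  refl  : ∀ {n t} → CloneCong R n t t
  sym   : ∀ {n t t'} → CloneCong R n t t' → CloneCong R n t' t
  trans : ∀ {n t t' t''} → CloneCong R n t t' → CloneCong R n t' t'' → CloneCong R n t t''
  sup   : ∀ {k n t t'} {σ σ' : Fin k → Term A n} →
          CloneCong R k t t' → (∀ i → CloneCong R n (σ i) (σ' i)) →
          CloneCong R n (t ⟦ σ ⟧) (t' ⟦ σ' ⟧)

module _ {c} {A : Set c} where
  private
    x₁ : ∀ {n} → Term A (suc n)
    x₁ = var zero
    x₂ : ∀ {n} → Term A (suc (suc n))
    x₂ = var (suc zero)
    x₃ : ∀ {n} → Term A (suc (suc (suc n)))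
    x₃ = var (suc (suc zero))

  data RM (_∙_ : Op₂ A) (e : A) : ∀ n → Term A n → Term A n → Set c where
    assoc   : RM _∙_ e 3 (star (star x₁ x₂) x₃) (star x₁ (star x₂ x₃))
    unitl   : RM _∙_ e 1 (star u x₁) x₁
    unitr   : RM _∙_ e 1 x₁ (star x₁ u)
    p-star  : ∀ α → RM _∙_ e 2 (p α (star x₁ x₂)) (star (p α x₁) (p α x₂))
    p-u     : ∀ α → RM _∙_ e 0 (p α u) u
    p-p     : ∀ α₁ α₂ → RM _∙_ e 1 (p α₁ (p α₂ x₁)) (p (α₁ ∙ α₂) x₁)
    p-e     : RM _∙_ e 1 (p e x₁) x₁

  private
    l : ∀ {n} → Fin n → A → Letter A n
    l i α = i , α
    1ˢ : ∀ {n} → Fin (suc n)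
    1ˢ = zero
    2ˢ : ∀ {n} → Fin (suc (suc n))
    2ˢ = suc zero
    3ˢ : ∀ {n} → Fin (suc (suc (suc n)))
    3ˢ = suc (suc zero)
    4ˢ : ∀ {n} → Fin (suc (suc (suc (suc n))))
    4ˢ = suc (suc (suc zero))

  data R'M (_∙_ : Op₂ A) (e : A) : ∀ n → Term A n → Term A n → Set c where
    old : ∀ {n t t'} → RM _∙_ e n t t' → R'M _∙_ e n t t'
    eq3a : ∀ α₁ α₂ α₃ → R'M _∙_ e 3
      (rc (l 1ˢ α₁ ∷ l 1ˢ α₂ ∷ l 2ˢ e ∷ l 3ˢ e ∷ l 1ˢ α₃ ∷ []))
      (rc (l 1ˢ α₁ ∷ l 2ˢ e ∷ l 1ˢ α₂ ∷ l 3ˢ e ∷ l 1ˢ α₃ ∷ []))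
    eq3b : ∀ α₁ α₂ α₃ → R'M _∙_ e 3
      (rc (l 1ˢ α₁ ∷ l 2ˢ e ∷ l 1ˢ α₂ ∷ l 3ˢ e ∷ l 1ˢ α₃ ∷ []))
      (rc (l 1ˢ α₁ ∷ l 2ˢ e ∷ l 3ˢ e ∷ l 1ˢ α₂ ∷ l 1ˢ α₃ ∷ []))
    eq4 : ∀ α₁ α₂ β₁ β₂ → R'M _∙_ e 4
      (rc (l 1ˢ α₁ ∷ l 2ˢ e ∷ l 3ˢ β₁ ∷ l 1ˢ α₂ ∷ l 4ˢ e ∷ l 3ˢ β₂ ∷ []))
      (rc (l 1ˢ α₁ ∷ l 2ˢ e ∷ l 1ˢ α₂ ∷ l 3ˢ β₁ ∷ l 4ˢ e ∷ l 3ˢ β₂ ∷ []))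

_≡R'[_,_]_ : ∀ {c} {A : Set c} {n} → Term A n → Op₂ A → A → Term A n → Set c
t ≡R'[ _∙_ , e ] t' = CloneCong (R'M _∙_ e) _ t t'

{-# OPTIONS --safe #-}
module Submission where

-- Reading off the leaves of a term, with pigments multiplied along the path,
-- gives a clone morphism toWord : T(G_M) → P(M) that kills R_M, and the extra
-- equations hold in Pill_{1,1}(M) since they only permute letters without
-- changing first or last occurrences of a value; ≡ is a congruence because the
-- first occurrences in a superposition only depend on the first occurrences in
-- its parts.  Conversely, every term is R_M-equal to the right comb of its word,
-- and the extra equations let two adjacent letters x y of a comb be swapped as
-- soon as the value of x or of y occurs before them and the value of x or of y
-- occurs after them.  Given ≡-equivalent words, the next letter y of the target
-- is found in the source and bubbled to the front: equality of first
-- occurrences provides the witnesses on the left (either y is a first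
-- occurrence, so every letter it crosses has its value already seen, or the
-- value of y was already seen), and equality of last occurrences those on the
-- right.

open import Defs hiding (refl; sym; trans)
open import Data.Nat using (ℕ)
open import Data.Fin using (Fin; zero; suc)
import Data.Fin as Fin
open import Data.Product using (Σ; ∃; ∃₂; _×_; _,_; proj₁; proj₂)
open import Data.Sum using (_⊎_; inj₁; inj₂; [_,_]′)
import Data.Sum
open import Data.Empty using (⊥-elim)
open import Data.Unit using (⊤; tt)
open import Data.List using (List; []; _∷_; _++_; map; reverse; [_])
open import Data.List.Properties
  using (∷-injective; ++-cancelˡ; ++-monoid; ++-assoc; ++-identityʳ; map-++; reverse-++; reverse-map; unfold-reverse; reverse-involutive)
open import Data.List.Relation.Unary.Any using (any?; here; there)
open import Data.List.Membership.Propositional using (_∈_; _∉_)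
open import Data.List.Membership.Propositional.Properties using (∈-∃++; ∈-map⁺; ∈-map⁻; ∈-++⁺ˡ; ∈-++⁺ʳ; ∈-++⁻)
open import Data.List.Relation.Binary.Subset.Propositional using (_⊆_)
open import Data.List.Relation.Binary.Subset.Propositional.Properties
  using (⊆-refl; ⊆-trans; ⊆-reflexive-↭; ∷⁺ʳ; ∈-∷⁺ʳ; xs⊆x∷xs; xs⊆ys++xs)
  renaming (++⁺ to ++⁺-⊆)
open import Data.List.Relation.Binary.Permutation.Propositional using (_↭_; ↭-sym; ↭-trans)
open import Data.List.Relation.Binary.Permutation.Propositional.Properties
  using (shift; shifts; drop-mid; drop-∷; ∈-resp-↭; ↭-empty-inv; ↭-reverse)
  renaming (map⁺ to map⁺-↭; ++⁺ˡ to ++⁺ˡ-↭; ++⁺ to ++⁺-↭)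
import Data.List.Relation.Binary.Permutation.Propositional as ↭
open import Relation.Nullary using (Dec; yes; no)
open import Relation.Binary.PropositionalEquality
  using (_≡_; refl; sym; trans; cong; cong₂; subst; subst₂; module ≡-Reasoning)
open import Function using (_∘_)
open import Algebra.Core using (Op₂)
open import Algebra.Structures using (IsMonoid)
open import Function.Bundles using (_⇔_; mk⇔)
open import Relation.Binary.Bundles using (Setoid)
import Relation.Binary.Reasoning.Setoid as SetoidReasoning

module _ {n : ℕ} where

  infix 4 _≐_
  _≐_ : List (Fin n) → List (Fin n) → Set
  S ≐ T = S ⊆ T × T ⊆ S

  ≐-refl : ∀ {S} → S ≐ S
  ≐-refl = ⊆-refl , ⊆-refl

  ≐-sym : ∀ {S T} → S ≐ T → T ≐ S
  ≐-sym (S⊆T , T⊆S) = T⊆S , S⊆T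

  ≐-trans : ∀ {S T U} → S ≐ T → T ≐ U → S ≐ U
  ≐-trans (S⊆T , T⊆S) (T⊆U , U⊆T) = ⊆-trans S⊆T T⊆U , ⊆-trans U⊆T T⊆S

  ∷⁺-≐ : ∀ j {S T} → S ≐ T → j ∷ S ≐ j ∷ T
  ∷⁺-≐ j (S⊆T , T⊆S) = ∷⁺ʳ j S⊆T , ∷⁺ʳ j T⊆S

  ++⁺-≐ : ∀ {S S′ T T′} → S ≐ S′ → T ≐ T′ → S ++ T ≐ S′ ++ T′
  ++⁺-≐ (S⊆S′ , S′⊆S) (T⊆T′ , T′⊆T) = ++⁺-⊆ S⊆S′ T⊆T′ , ++⁺-⊆ S′⊆S T′⊆T

  ↭⇒≐ : ∀ {S T} → S ↭ T → S ≐ T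
  ↭⇒≐ S↭T = ⊆-reflexive-↭ S↭T , ⊆-reflexive-↭ (↭-sym S↭T)

  ∈⇒∷-≐ : ∀ {j S} → j ∈ S → j ∷ S ≐ S
  ∈⇒∷-≐ {S = S} j∈S = ∈-∷⁺ʳ j∈S ⊆-refl , xs⊆x∷xs S _

  -- Literally the test made by first1-from, so that `with mem? …` unfolds it.
  mem? : (j : Fin n) (S : List (Fin n)) → Dec (j ∈ S)
  mem? j S = any? (λ k → j Fin.≟ k) S

module _ {c} {A : Set c} {n : ℕ} where

  vals : Word A n → List (Fin n)
  vals = map proj₁

  vals-++ : ∀ (xs ys : Word A n) → vals (xs ++ ys) ≡ vals xs ++ vals ys
  vals-++ = map-++ proj₁

  ∈-vals-++⁺ʳ : ∀ {j} (xs : Word A n) {ys} → j ∈ vals ys → j ∈ vals (xs ++ ys)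
  ∈-vals-++⁺ʳ xs {ys} j∈ys = subst (_ ∈_) (sym (vals-++ xs ys)) (∈-++⁺ʳ (vals xs) j∈ys)

  ∈-vals-++⁺ˡ : ∀ {j} (xs : Word A n) {ys} → j ∈ vals xs → j ∈ vals (xs ++ ys)
  ∈-vals-++⁺ˡ xs {ys} j∈xs = subst (_ ∈_) (sym (vals-++ xs ys)) (∈-++⁺ˡ j∈xs)

  ∈-vals-++⁻ : ∀ {j} (xs : Word A n) {ys} → j ∈ vals (xs ++ ys) → j ∈ vals xs ⊎ j ∈ vals ys
  ∈-vals-++⁻ xs {ys} j∈ = ∈-++⁻ (vals xs) (subst (_ ∈_) (vals-++ xs ys) j∈)

  split-at-value : ∀ {j} (X : Word A n) → j ∈ vals X → ∃₂ λ X₁ X₂ → ∃ λ α → X ≡ X₁ ++ (j , α) ∷ X₂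
  split-at-value X j∈X with ∈-map⁻ proj₁ j∈X
  ... | (j , α) , jα∈X , refl with ∈-∃++ jα∈X
  ...   | X₁ , X₂ , X≡ = X₁ , X₂ , α , X≡

  ↭⇒vals-≐ : ∀ {w w′ : Word A n} → w ↭ w′ → vals w ≐ vals w′
  ↭⇒vals-≐ w↭w′ = ↭⇒≐ (map⁺-↭ proj₁ w↭w′)

  vals-++⁺ʳ-≐ : ∀ (P : Word A n) {r r′} → vals r ≐ vals r′ → vals (P ++ r) ≐ vals (P ++ r′)
  vals-++⁺ʳ-≐ P {r} {r′} r≐r′ =
    subst₂ _≐_ (sym (vals-++ P r)) (sym (vals-++ P r′)) (++⁺-≐ (≐-refl {S = vals P}) r≐r′)

  -- α ⊙ w is recolour (α ∙_) w definitionally.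
  recolour : (A → A) → Word A n → Word A n
  recolour h = map (λ l → proj₁ l , h (proj₂ l))

  vals-recolour : ∀ h (w : Word A n) → vals (recolour h w) ≡ vals w
  vals-recolour h [] = refl
  vals-recolour h (l ∷ w) = cong (proj₁ l ∷_) (vals-recolour h w)

  first1-from-∈ : ∀ {S} (l : Letter A n) w → proj₁ l ∈ S → first1-from S (l ∷ w) ≡ first1-from S w
  first1-from-∈ {S} l w l∈S with mem? (proj₁ l) S
  ... | yes _ = refl
  ... | no l∉S = ⊥-elim (l∉S l∈S)

  first1-from-∉ : ∀ {S} (l : Letter A n) w → proj₁ l ∉ S →
                  first1-from S (l ∷ w) ≡ l ∷ first1-from (proj₁ l ∷ S) w
  first1-from-∉ {S} l w l∉S with mem? (proj₁ l) S
  ... | yes l∈S = ⊥-elim (l∉S l∈S)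
  ... | no _ = refl

  first1-from-cong : ∀ {S T} → S ≐ T → ∀ (w : Word A n) → first1-from S w ≡ first1-from T w
  first1-from-cong S≐T [] = refl
  first1-from-cong {S} {T} S≐T (l ∷ w) with mem? (proj₁ l) S | mem? (proj₁ l) T
  ... | yes _ | yes _ = first1-from-cong S≐T w
  ... | no _ | no _ = cong (l ∷_) (first1-from-cong (∷⁺-≐ (proj₁ l) S≐T) w)
  ... | yes l∈S | no l∉T = ⊥-elim (l∉T (proj₁ S≐T l∈S))
  ... | no l∉S | yes l∈T = ⊥-elim (l∉S (proj₂ S≐T l∈T))

  first1-from-++ : ∀ S (xs ys : Word A n) →
                   first1-from S (xs ++ ys) ≡ first1-from S xs ++ first1-from (vals xs ++ S) ys
  first1-from-++ S [] ys = refl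
  first1-from-++ S (l ∷ xs) ys with mem? (proj₁ l) S
  ... | yes l∈S = trans (first1-from-++ S xs ys) (cong (first1-from S xs ++_)
                    (first1-from-cong (≐-sym (∈⇒∷-≐ (∈-++⁺ʳ (vals xs) l∈S))) ys))
  ... | no _ = cong (l ∷_) (trans (first1-from-++ (proj₁ l ∷ S) xs ys) (cong (first1-from (proj₁ l ∷ S) xs ++_)
                 (first1-from-cong (↭⇒≐ (shift (proj₁ l) (vals xs) S)) ys)))

  first1-from-first1-from : ∀ {S T} (w : Word A n) → T ⊆ S → first1-from S (first1-from T w) ≡ first1-from S w
  first1-from-first1-from [] T⊆S = refl
  first1-from-first1-from {S} {T} (l ∷ w) T⊆S with mem? (proj₁ l) T
  ... | yes l∈T = trans (first1-from-first1-from w T⊆S) (sym (first1-from-∈ l w (T⊆S l∈T)))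
  ... | no _ with mem? (proj₁ l) S
  ...   | yes l∈S = first1-from-first1-from w (∈-∷⁺ʳ l∈S T⊆S)
  ...   | no _ = cong (l ∷_) (first1-from-first1-from w (∷⁺ʳ (proj₁ l) T⊆S))

  first1-from-⊆ : ∀ {S} (w : Word A n) → vals w ⊆ S → first1-from S w ≡ []
  first1-from-⊆ [] _ = refl
  first1-from-⊆ (l ∷ w) w⊆S = trans (first1-from-∈ l w (w⊆S (here refl))) (first1-from-⊆ w (w⊆S ∘ there))

  vals-first1-from : ∀ T (w : Word A n) → vals w ++ T ≐ vals (first1-from T w) ++ T
  vals-first1-from T [] = ≐-refl
  vals-first1-from T (l ∷ w) with mem? (proj₁ l) T
  ... | yes l∈T = ≐-trans (∈⇒∷-≐ (∈-++⁺ʳ (vals w) l∈T)) (vals-first1-from T w)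
  ... | no _ = ≐-trans (↭⇒≐ (↭-sym (shift (proj₁ l) (vals w) T)))
                 (≐-trans (vals-first1-from (proj₁ l ∷ T) w)
                          (↭⇒≐ (shift (proj₁ l) (vals (first1-from (proj₁ l ∷ T) w)) T)))

  first1-from-recolour : ∀ S h (w : Word A n) → first1-from S (recolour h w) ≡ recolour h (first1-from S w)
  first1-from-recolour S h [] = refl
  first1-from-recolour S h (l ∷ w) with mem? (proj₁ l) S
  ... | yes _ = first1-from-recolour S h w
  ... | no _ = cong (_ ∷_) (first1-from-recolour (proj₁ l ∷ S) h w)

  rightWitnesses : Word A n → Word A n
  rightWitnesses [] = []
  rightWitnesses (l ∷ w) with mem? (proj₁ l) (vals w)
  ... | yes _ = rightWitnesses w
  ... | no _ = l ∷ rightWitnesses w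

  rightWitnesses-∈ : ∀ (l : Letter A n) w → proj₁ l ∈ vals w → rightWitnesses (l ∷ w) ≡ rightWitnesses w
  rightWitnesses-∈ l w l∈w with mem? (proj₁ l) (vals w)
  ... | yes _ = refl
  ... | no l∉w = ⊥-elim (l∉w l∈w)

  rightWitnesses-∉ : ∀ (l : Letter A n) w → proj₁ l ∉ vals w → rightWitnesses (l ∷ w) ≡ l ∷ rightWitnesses w
  rightWitnesses-∉ l w l∉w with mem? (proj₁ l) (vals w)
  ... | yes l∈w = ⊥-elim (l∉w l∈w)
  ... | no _ = refl

  rightWitnesses-⊆ : ∀ (w : Word A n) → rightWitnesses w ⊆ w
  rightWitnesses-⊆ (l ∷ w) z∈ with mem? (proj₁ l) (vals w)
  ... | yes _ = there (rightWitnesses-⊆ w z∈)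
  rightWitnesses-⊆ (l ∷ w) (here z≡l) | no _ = here z≡l
  rightWitnesses-⊆ (l ∷ w) (there z∈) | no _ = there (rightWitnesses-⊆ w z∈)

  ∈-rightWitnesses : ∀ (y : Letter A n) r₁ r₂ → proj₁ y ∉ vals r₂ → y ∈ rightWitnesses (r₁ ++ y ∷ r₂)
  ∈-rightWitnesses y [] r₂ y∉r₂ = subst (y ∈_) (sym (rightWitnesses-∉ y r₂ y∉r₂)) (here refl)
  ∈-rightWitnesses y (l ∷ r₁) r₂ y∉r₂ with mem? (proj₁ l) (vals (r₁ ++ y ∷ r₂))
  ... | yes _ = ∈-rightWitnesses y r₁ r₂ y∉r₂
  ... | no _ = there (∈-rightWitnesses y r₁ r₂ y∉r₂)

  rightWitnesses-cancelˡ : ∀ (P : Word A n) {r r′} → vals r ≐ vals r′ →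
                           rightWitnesses (P ++ r) ≡ rightWitnesses (P ++ r′) → rightWitnesses r ≡ rightWitnesses r′
  rightWitnesses-cancelˡ [] _ eq = eq
  rightWitnesses-cancelˡ (l ∷ P) {r} {r′} r≐r′ eq
    with mem? (proj₁ l) (vals (P ++ r)) | mem? (proj₁ l) (vals (P ++ r′))
  ... | yes _ | yes _ = rightWitnesses-cancelˡ P r≐r′ eq
  ... | no _ | no _ = rightWitnesses-cancelˡ P r≐r′ (proj₂ (∷-injective eq))
  ... | yes l∈Pr | no l∉Pr′ = ⊥-elim (l∉Pr′ (proj₁ (vals-++⁺ʳ-≐ P r≐r′) l∈Pr))
  ... | no l∉Pr | yes l∈Pr′ = ⊥-elim (l∉Pr (proj₂ (vals-++⁺ʳ-≐ P r≐r′) l∈Pr′))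

  first1R-∷ : ∀ (l : Letter A n) w → first1R (l ∷ w) ≡ reverse (first1-from (vals w) [ l ]) ++ first1R w
  first1R-∷ l w = begin
    reverse (first1 (reverse (l ∷ w)))
      ≡⟨ cong (reverse ∘ first1) (unfold-reverse l w) ⟩
    reverse (first1 (reverse w ++ [ l ]))
      ≡⟨ cong reverse (first1-from-++ [] (reverse w) [ l ]) ⟩
    reverse (first1 (reverse w) ++ first1-from (vals (reverse w) ++ []) [ l ])
      ≡⟨ cong (λ F → reverse (first1 (reverse w) ++ F)) (first1-from-cong reversed-vals [ l ]) ⟩
    reverse (first1 (reverse w) ++ first1-from (vals w) [ l ])
      ≡⟨ reverse-++ (first1 (reverse w)) _ ⟩
    reverse (first1-from (vals w) [ l ]) ++ first1R w ∎
    where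
    open ≡-Reasoning
    reversed-vals : vals (reverse w) ++ [] ≐ vals w
    reversed-vals rewrite ++-identityʳ (vals (reverse w)) | reverse-map proj₁ w = ↭⇒≐ (↭-reverse (vals w))

  first1R≡rightWitnesses : ∀ (w : Word A n) → first1R w ≡ rightWitnesses w
  first1R≡rightWitnesses [] = refl
  first1R≡rightWitnesses (l ∷ w) rewrite first1R-∷ l w with mem? (proj₁ l) (vals w)
  ... | yes _ = first1R≡rightWitnesses w
  ... | no _ = cong (l ∷_) (first1R≡rightWitnesses w)

  ++-cancelˡ-↭ : ∀ (P : Word A n) {r r′} → P ++ r ↭ P ++ r′ → r ↭ r′
  ++-cancelˡ-↭ [] Pr↭Pr′ = Pr↭Pr′
  ++-cancelˡ-↭ (l ∷ P) Pr↭Pr′ = ++-cancelˡ-↭ P (drop-∷ Pr↭Pr′)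

  first1-from-cancelˡ : ∀ (P : Word A n) {r r′} → first1 (P ++ r) ≡ first1 (P ++ r′) →
                        first1-from (vals P) r ≡ first1-from (vals P) r′
  first1-from-cancelˡ P {r} {r′} eq = begin
    first1-from (vals P) r          ≡⟨ first1-from-cong P≐P++[] r ⟩
    first1-from (vals P ++ []) r    ≡⟨ ++-cancelˡ (first1 P) _ _ (trans (sym (first1-from-++ [] P r)) (trans eq (first1-from-++ [] P r′))) ⟩
    first1-from (vals P ++ []) r′   ≡⟨ first1-from-cong (≐-sym P≐P++[]) r′ ⟩
    first1-from (vals P) r′ ∎
    where
    open ≡-Reasoning
    P≐P++[] : vals P ≐ vals P ++ []
    P≐P++[] = subst (vals P ≐_) (sym (++-identityʳ (vals P))) ≐-refl

  vals-first1 : ∀ (w : Word A n) → vals w ≐ vals (first1 w)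
  vals-first1 w = subst₂ _≐_ (++-identityʳ (vals w)) (++-identityʳ (vals (first1 w))) (vals-first1-from [] w)

  first1R-reverse : ∀ (w w′ : Word A n) → first1R w ≡ first1R w′ → first1 (reverse w) ≡ first1 (reverse w′)
  first1R-reverse w w′ eq = begin
    first1 (reverse w)                       ≡⟨ sym (reverse-involutive _) ⟩
    reverse (first1R w)                      ≡⟨ cong reverse eq ⟩
    reverse (first1R w′)                     ≡⟨ reverse-involutive _ ⟩
    first1 (reverse w′) ∎
    where open ≡-Reasoning

module _ {c} {A : Set c} (_∙_ : Op₂ A) {k m : ℕ} where

  private
    ws : Word A k → (Fin k → Word A m) → Word A m
    ws = wsup _∙_

  wsup-≗ : ∀ (w : Word A k) {ps ps′ : Fin k → Word A m} → (∀ i → ps i ≡ ps′ i) → ws w ps ≡ ws w ps′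
  wsup-≗ [] _ = refl
  wsup-≗ ((i , α) ∷ w) ps≗ps′ = cong₂ _++_ (cong (recolour (α ∙_)) (ps≗ps′ i)) (wsup-≗ w ps≗ps′)

  wsup-++ : ∀ (w w′ : Word A k) ps → ws (w ++ w′) ps ≡ ws w ps ++ ws w′ ps
  wsup-++ [] w′ ps = refl
  wsup-++ ((i , α) ∷ w) w′ ps =
    trans (cong (recolour (α ∙_) (ps i) ++_) (wsup-++ w w′ ps)) (sym (++-assoc (recolour (α ∙_) (ps i)) _ _))

  reverse-wsup : ∀ (w : Word A k) ps → reverse (ws w ps) ≡ ws (reverse w) (reverse ∘ ps)
  reverse-wsup [] ps = refl
  reverse-wsup ((i , α) ∷ w) ps = begin
    reverse (recolour (α ∙_) (ps i) ++ ws w ps)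
      ≡⟨ reverse-++ (recolour (α ∙_) (ps i)) (ws w ps) ⟩
    reverse (ws w ps) ++ reverse (recolour (α ∙_) (ps i))
      ≡⟨ cong₂ _++_ (reverse-wsup w ps) (trans (sym (reverse-map _ (ps i))) (sym (++-identityʳ _))) ⟩
    ws (reverse w) (reverse ∘ ps) ++ ws [ (i , α) ] (reverse ∘ ps)
      ≡⟨ sym (wsup-++ (reverse w) [ (i , α) ] (reverse ∘ ps)) ⟩
    ws (reverse w ++ [ (i , α) ]) (reverse ∘ ps)
      ≡⟨ cong (λ v → ws v (reverse ∘ ps)) (sym (unfold-reverse (i , α) w)) ⟩
    ws (reverse ((i , α) ∷ w)) (reverse ∘ ps) ∎
    where open ≡-Reasoning

  wsup-↭ˡ : ∀ {w w′ : Word A k} ps → w ↭ w′ → ws w ps ↭ ws w′ ps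
  wsup-↭ˡ ps ↭.refl = ↭.refl
  wsup-↭ˡ ps (↭.prep (i , α) w↭w′) = ++⁺ˡ-↭ (recolour (α ∙_) (ps i)) (wsup-↭ˡ ps w↭w′)
  wsup-↭ˡ ps (↭.swap (i , α) (j , β) w↭w′) =
    ↭-trans (++⁺ˡ-↭ (recolour (α ∙_) (ps i)) (++⁺ˡ-↭ (recolour (β ∙_) (ps j)) (wsup-↭ˡ ps w↭w′)))
            (shifts (recolour (α ∙_) (ps i)) (recolour (β ∙_) (ps j)))
  wsup-↭ˡ ps (↭.trans w↭w′ w′↭w″) = ↭-trans (wsup-↭ˡ ps w↭w′) (wsup-↭ˡ ps w′↭w″)

  wsup-↭ʳ : ∀ (w : Word A k) {ps ps′} → (∀ i → ps i ↭ ps′ i) → ws w ps ↭ ws w ps′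
  wsup-↭ʳ [] _ = ↭.refl
  wsup-↭ʳ ((i , α) ∷ w) ps↭ps′ = ++⁺-↭ (map⁺-↭ _ (ps↭ps′ i)) (wsup-↭ʳ w ps↭ps′)

  first1-from-wsup-first1 : ∀ {S S′} → S ≐ S′ → ∀ (w : Word A k) ps →
                            first1-from S (ws w ps) ≡ first1-from S′ (ws w (first1 ∘ ps))
  first1-from-wsup-first1 S≐S′ [] ps = refl
  first1-from-wsup-first1 {S} {S′} S≐S′ ((i , α) ∷ w) ps = begin
    first1-from S (X ++ ws w ps)
      ≡⟨ first1-from-++ S X (ws w ps) ⟩
    first1-from S X ++ first1-from (vals X ++ S) (ws w ps)
      ≡⟨ cong₂ _++_ head-part (first1-from-wsup-first1 seen-after-head w ps) ⟩
    first1-from S′ X′ ++ first1-from (vals X′ ++ S′) (ws w (first1 ∘ ps))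
      ≡⟨ sym (first1-from-++ S′ X′ (ws w (first1 ∘ ps))) ⟩
    first1-from S′ (X′ ++ ws w (first1 ∘ ps)) ∎
    where
    open ≡-Reasoning
    X X′ : Word A m
    X = recolour (α ∙_) (ps i)
    X′ = recolour (α ∙_) (first1 (ps i))
    head-part : first1-from S X ≡ first1-from S′ X′
    head-part = begin
      first1-from S X                                       ≡⟨ first1-from-recolour S (α ∙_) (ps i) ⟩
      recolour (α ∙_) (first1-from S (ps i))                ≡⟨ cong (recolour (α ∙_)) (sym (first1-from-first1-from (ps i) (λ ()))) ⟩
      recolour (α ∙_) (first1-from S (first1 (ps i)))       ≡⟨ cong (recolour (α ∙_)) (first1-from-cong S≐S′ (first1 (ps i))) ⟩
      recolour (α ∙_) (first1-from S′ (first1 (ps i)))      ≡⟨ sym (first1-from-recolour S′ (α ∙_) (first1 (ps i))) ⟩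
      first1-from S′ X′ ∎
    seen-after-head : vals X ++ S ≐ vals X′ ++ S′
    seen-after-head rewrite vals-recolour (α ∙_) (ps i) | vals-recolour (α ∙_) (first1 (ps i)) =
      ++⁺-≐ (vals-first1 (ps i)) S≐S′

  first1-from-wsup-first1-from : ∀ S T (w : Word A k) ps → (∀ {i} → i ∈ T → vals (ps i) ⊆ S) →
                                 first1-from S (ws w ps) ≡ first1-from S (ws (first1-from T w) ps)
  first1-from-wsup-first1-from S T [] ps T-seen = refl
  first1-from-wsup-first1-from S T ((i , α) ∷ w) ps T-seen with mem? i T
  ... | yes i∈T = begin
    first1-from S (X ++ ws w ps)                           ≡⟨ first1-from-++ S X (ws w ps) ⟩
    first1-from S X ++ first1-from (vals X ++ S) (ws w ps) ≡⟨ cong₂ _++_ (first1-from-⊆ X X⊆S) (first1-from-cong X++S≐S (ws w ps)) ⟩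
    first1-from S (ws w ps)                                ≡⟨ first1-from-wsup-first1-from S T w ps T-seen ⟩
    first1-from S (ws (first1-from T w) ps) ∎
    where
    open ≡-Reasoning
    X = recolour (α ∙_) (ps i)
    X⊆S : vals X ⊆ S
    X⊆S rewrite vals-recolour (α ∙_) (ps i) = T-seen i∈T
    X++S≐S : vals X ++ S ≐ S
    X++S≐S = (λ j∈ → [ X⊆S , (λ j∈S → j∈S) ]′ (∈-++⁻ (vals X) j∈)) , xs⊆ys++xs S (vals X)
  ... | no _ = begin
    first1-from S (X ++ ws w ps)                           ≡⟨ first1-from-++ S X (ws w ps) ⟩
    first1-from S X ++ first1-from (vals X ++ S) (ws w ps) ≡⟨ cong (first1-from S X ++_)
                                                                (first1-from-wsup-first1-from (vals X ++ S) (i ∷ T) w ps i∷T-seen) ⟩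
    first1-from S X ++ first1-from (vals X ++ S) (ws (first1-from (i ∷ T) w) ps)
                                                           ≡⟨ sym (first1-from-++ S X _) ⟩
    first1-from S (X ++ ws (first1-from (i ∷ T) w) ps) ∎
    where
    open ≡-Reasoning
    X = recolour (α ∙_) (ps i)
    i∷T-seen : ∀ {j} → j ∈ i ∷ T → vals (ps j) ⊆ vals X ++ S
    i∷T-seen (here refl) j∈ = ∈-++⁺ˡ (subst (_ ∈_) (sym (vals-recolour (α ∙_) (ps i))) j∈)
    i∷T-seen (there j∈T) j∈ = ∈-++⁺ʳ (vals X) (T-seen j∈T j∈)

  first1-wsup : ∀ (w : Word A k) ps → first1 (ws w ps) ≡ first1 (ws (first1 w) (first1 ∘ ps))
  first1-wsup w ps = trans (first1-from-wsup-first1 ≐-refl w ps) (first1-from-wsup-first1-from [] [] w _ (λ ()))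

  first1-wsup-cong : ∀ {w w′ : Word A k} {ps ps′} → first1 w ≡ first1 w′ → (∀ i → first1 (ps i) ≡ first1 (ps′ i)) →
                     first1 (ws w ps) ≡ first1 (ws w′ ps′)
  first1-wsup-cong {w} {w′} {ps} {ps′} eq eqs = begin
    first1 (ws w ps)                          ≡⟨ first1-wsup w ps ⟩
    first1 (ws (first1 w) (first1 ∘ ps))      ≡⟨ cong₂ (λ v qs → first1 (ws v qs)) eq refl ⟩
    first1 (ws (first1 w′) (first1 ∘ ps))     ≡⟨ cong first1 (wsup-≗ (first1 w′) eqs) ⟩
    first1 (ws (first1 w′) (first1 ∘ ps′))    ≡⟨ sym (first1-wsup w′ ps′) ⟩
    first1 (ws w′ ps′) ∎
    where open ≡-Reasoning

  first1R-wsup-cong : ∀ {w w′ : Word A k} {ps ps′} → first1R w ≡ first1R w′ → (∀ i → first1R (ps i) ≡ first1R (ps′ i)) →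
                      first1R (ws w ps) ≡ first1R (ws w′ ps′)
  first1R-wsup-cong {w} {w′} {ps} {ps′} eq eqs = begin
    reverse (first1 (reverse (ws w ps)))                     ≡⟨ cong (reverse ∘ first1) (reverse-wsup w ps) ⟩
    reverse (first1 (ws (reverse w) (reverse ∘ ps)))         ≡⟨ cong reverse (first1-wsup-cong {reverse w} {reverse w′} {reverse ∘ ps} {reverse ∘ ps′}
                                                                  (first1R-reverse w w′ eq) (λ i → first1R-reverse (ps i) (ps′ i) (eqs i))) ⟩
    reverse (first1 (ws (reverse w′) (reverse ∘ ps′)))       ≡⟨ cong (reverse ∘ first1) (sym (reverse-wsup w′ ps′)) ⟩
    reverse (first1 (reverse (ws w′ ps′))) ∎
    where open ≡-Reasoning

  wsup-cong : ∀ {w w′ : Word A k} {ps ps′ : Fin k → Word A m} → PillEq w w′ → (∀ i → PillEq (ps i) (ps′ i)) →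
              PillEq (ws w ps) (ws w′ ps′)
  wsup-cong {w} {w′} {ps} {ps′} (w↭w′ , first1≡ , first1R≡) ps≈ps′ =
    ↭-trans (wsup-↭ˡ ps w↭w′) (wsup-↭ʳ w′ (proj₁ ∘ ps≈ps′)) ,
    first1-wsup-cong {w} {w′} {ps} {ps′} first1≡ (proj₁ ∘ proj₂ ∘ ps≈ps′) ,
    first1R-wsup-cong {w} {w′} {ps} {ps′} first1R≡ (proj₂ ∘ proj₂ ∘ ps≈ps′)

module _ {a} {L : Set a} where
  open import Algebra.Solver.Monoid (++-monoid L) using (solve; _⊕_; _⊜_)

  ++-reframe : ∀ (A₁ A₂ B₁ B₂ : List L) l r x y →
               (A₁ ++ l ∷ A₂) ++ x ∷ y ∷ B₁ ++ r ∷ B₂ ≡ A₁ ++ (l ∷ A₂ ++ x ∷ y ∷ B₁ ++ [ r ]) ++ B₂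
  ++-reframe A₁ A₂ B₁ B₂ l r x y =
    solve 8 (λ A₁ A₂ B₁ B₂ l r x y → (A₁ ⊕ (l ⊕ A₂)) ⊕ (x ⊕ (y ⊕ (B₁ ⊕ (r ⊕ B₂))))
                                    ⊜ A₁ ⊕ ((l ⊕ (A₂ ⊕ (x ⊕ (y ⊕ (B₁ ⊕ r))))) ⊕ B₂))
          refl A₁ A₂ B₁ B₂ [ l ] [ r ] [ x ] [ y ]

module _ {c} {A : Set c} {n : ℕ} where

  PillEq-refl : ∀ {w : Word A n} → PillEq w w
  PillEq-refl = ↭.refl , refl , refl

  PillEq-sym : ∀ {w w′ : Word A n} → PillEq w w′ → PillEq w′ w
  PillEq-sym (w↭w′ , eq , eqR) = ↭-sym w↭w′ , sym eq , sym eqR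

  PillEq-trans : ∀ {w w′ w″ : Word A n} → PillEq w w′ → PillEq w′ w″ → PillEq w w″
  PillEq-trans (w↭w′ , eq , eqR) (w′↭w″ , eq′ , eqR′) = ↭-trans w↭w′ w′↭w″ , trans eq eq′ , trans eqR eqR′

  ≡⇒PillEq : ∀ {w w′ : Word A n} → w ≡ w′ → PillEq w w′
  ≡⇒PillEq refl = PillEq-refl

module _ {c} {A : Set c} {n : ℕ} where

  PillEq-cancelˡ : ∀ (P : Word A n) {r r′} → PillEq (P ++ r) (P ++ r′) →
                   r ↭ r′ × first1-from (vals P) r ≡ first1-from (vals P) r′ × rightWitnesses r ≡ rightWitnesses r′
  PillEq-cancelˡ P {r} {r′} (Pr↭Pr′ , first1≡ , first1R≡) =
    r↭r′ , first1-from-cancelˡ P first1≡ ,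
    rightWitnesses-cancelˡ P (↭⇒vals-≐ r↭r′)
      (trans (sym (first1R≡rightWitnesses (P ++ r))) (trans first1R≡ (first1R≡rightWitnesses (P ++ r′))))
    where
    r↭r′ = ++-cancelˡ-↭ P Pr↭Pr′

  -- Side conditions of rc-swap for moving y leftwards across each letter of r₁.
  LeftSeen : Word A n → Word A n → Letter A n → Set c
  LeftSeen P r₁ y = ∀ {x} → x ∈ r₁ → proj₁ x ∈ vals P ⊎ proj₁ y ∈ vals P

  RightSeen : Word A n → Letter A n → Word A n → Set
  RightSeen [] y r₂ = ⊤
  RightSeen (x ∷ r₁) y r₂ = (proj₁ x ∈ vals (r₁ ++ r₂) ⊎ proj₁ y ∈ vals (r₁ ++ r₂)) × RightSeen r₁ y r₂

  rightSeen-of-later : ∀ (r₁ r₂ : Word A n) y → proj₁ y ∈ vals r₂ → RightSeen r₁ y r₂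
  rightSeen-of-later [] r₂ y y∈r₂ = tt
  rightSeen-of-later (x ∷ r₁) r₂ y y∈r₂ = inj₂ (∈-vals-++⁺ʳ r₁ y∈r₂) , rightSeen-of-later r₁ r₂ y y∈r₂

  rightSeen-of-rightWitness : ∀ (r₁ r₂ : Word A n) y t → proj₁ y ∉ vals r₁ →
                              rightWitnesses (r₁ ++ y ∷ r₂) ≡ y ∷ t → RightSeen r₁ y r₂
  rightSeen-of-rightWitness [] r₂ y t _ _ = tt
  rightSeen-of-rightWitness (x ∷ r₁) r₂ y t y∉xr₁ rw≡ with mem? (proj₁ x) (vals (r₁ ++ y ∷ r₂))
  ... | yes x∈ = inj₁ (drop-y x∈) , rightSeen-of-rightWitness r₁ r₂ y t (y∉xr₁ ∘ there) rw≡
    where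
    drop-y : proj₁ x ∈ vals (r₁ ++ y ∷ r₂) → proj₁ x ∈ vals (r₁ ++ r₂)
    drop-y x∈ with ∈-vals-++⁻ r₁ x∈
    ... | inj₁ x∈r₁ = ∈-vals-++⁺ˡ r₁ x∈r₁
    ... | inj₂ (here x≡y) = ⊥-elim (y∉xr₁ (here (sym x≡y)))
    ... | inj₂ (there x∈r₂) = ∈-vals-++⁺ʳ r₁ x∈r₂
  ... | no _ = ⊥-elim (y∉xr₁ (here (cong proj₁ (sym (proj₁ (∷-injective rw≡))))))

  rightSeen-of-fresh : ∀ {r s : Word A n} {y} r₁ r₂ → r ↭ y ∷ s → rightWitnesses r ≡ rightWitnesses (y ∷ s) →
                       r ≡ r₁ ++ y ∷ r₂ → proj₁ y ∉ vals r₁ → RightSeen r₁ y r₂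
  rightSeen-of-fresh {r} {s} {y} r₁ r₂ r↭ys rw≡ refl y∉r₁ with mem? (proj₁ y) (vals s)
  ... | yes y∈s = rightSeen-of-later r₁ r₂ y (in-r₂ (∈-vals-++⁻ r₁ (proj₂ (↭⇒vals-≐ r₁r₂↭s) y∈s)))
    where
    r₁r₂↭s = drop-mid r₁ [] r↭ys
    in-r₂ : proj₁ y ∈ vals r₁ ⊎ proj₁ y ∈ vals r₂ → proj₁ y ∈ vals r₂
    in-r₂ (inj₁ y∈r₁) = ⊥-elim (y∉r₁ y∈r₁)
    in-r₂ (inj₂ y∈r₂) = y∈r₂
  ... | no _ = rightSeen-of-rightWitness r₁ r₂ y (rightWitnesses s) y∉r₁ rw≡

  rightSeen-split : ∀ {r s : Word A n} {y} → r ↭ y ∷ s → rightWitnesses r ≡ rightWitnesses (y ∷ s) →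
                    ∃₂ λ r₁ r₂ → r ≡ r₁ ++ y ∷ r₂ × RightSeen r₁ y r₂
  rightSeen-split {r} {s} {y} r↭ys rw≡ with ∈-∃++ (∈-resp-↭ (↭-sym r↭ys) (here refl))
  ... | r₁ , r₂ , refl with mem? (proj₁ y) (vals r₂) | mem? (proj₁ y) (vals r₁)
  ...   | yes y∈r₂ | _ = r₁ , r₂ , refl , rightSeen-of-later r₁ r₂ y y∈r₂
  ...   | no _ | no y∉r₁ = r₁ , r₂ , refl , rightSeen-of-fresh r₁ r₂ r↭ys rw≡ refl y∉r₁
  ...   | no y∉r₂ | yes y∈r₁ with ∈-∃++ earlier-copy
    where
    y∈s : proj₁ y ∈ vals s
    y∈s = proj₁ (↭⇒vals-≐ (drop-mid r₁ [] r↭ys)) (∈-vals-++⁺ˡ r₁ y∈r₁)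
    -- y is the last letter of its value in r, hence a right witness of r, hence of s
    y∈rw-s : y ∈ rightWitnesses s
    y∈rw-s = subst (y ∈_) (trans rw≡ (rightWitnesses-∈ y s y∈s)) (∈-rightWitnesses y r₁ r₂ y∉r₂)
    earlier-copy : y ∈ r₁
    earlier-copy with ∈-++⁻ r₁ (∈-resp-↭ (↭-sym (drop-mid r₁ [] r↭ys)) (rightWitnesses-⊆ s y∈rw-s))
    ... | inj₁ y∈r₁′ = y∈r₁′
    ... | inj₂ y∈r₂′ = ⊥-elim (y∉r₂ (∈-map⁺ proj₁ y∈r₂′))
  ...     | r₁₁ , r₁₂ , refl = r₁₁ , r₁₂ ++ y ∷ r₂ , ++-assoc r₁₁ (y ∷ r₁₂) (y ∷ r₂) ,
                               rightSeen-of-later r₁₁ (r₁₂ ++ y ∷ r₂) y (∈-vals-++⁺ʳ r₁₂ (here refl))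

  first1-from-split : ∀ S (r : Word A n) y t → first1-from S r ≡ y ∷ t →
                      ∃₂ λ r₁ r₂ → r ≡ r₁ ++ y ∷ r₂ × (∀ {x} → x ∈ r₁ → proj₁ x ∈ S)
  first1-from-split S (l ∷ r) y t eq with mem? (proj₁ l) S
  ... | yes l∈S with first1-from-split S r y t eq
  ...   | r₁ , r₂ , refl , r₁⊆S = l ∷ r₁ , r₂ , refl , λ { (here refl) → l∈S ; (there x∈r₁) → r₁⊆S x∈r₁ }
  first1-from-split S (l ∷ r) y t refl | no _ = [] , r , refl , λ ()

  crossing-split : ∀ (P r : Word A n) y s → PillEq (P ++ r) (P ++ y ∷ s) →
                   ∃₂ λ r₁ r₂ → r ≡ r₁ ++ y ∷ r₂ × LeftSeen P r₁ y × RightSeen r₁ y r₂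
  crossing-split P r y s Pr≈Pys with PillEq-cancelˡ P Pr≈Pys | mem? (proj₁ y) (vals P)
  ... | r↭ys , _ , rw≡ | yes y∈P with rightSeen-split r↭ys rw≡
  ...   | r₁ , r₂ , r≡ , rs = r₁ , r₂ , r≡ , (λ _ → inj₂ y∈P) , rs
  crossing-split P r y s Pr≈Pys | r↭ys , first1≡ , rw≡ | no y∉P
    with first1-from-split (vals P) r y _ (trans first1≡ (first1-from-∉ y s y∉P))
  ... | r₁ , r₂ , r≡ , r₁⊆P = r₁ , r₂ , r≡ , inj₁ ∘ r₁⊆P , rightSeen-of-fresh r₁ r₂ r↭ys rw≡ r≡ y∉r₁
    where
    y∉r₁ : proj₁ y ∉ vals r₁
    y∉r₁ y∈r₁ with ∈-map⁻ proj₁ y∈r₁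
    ... | x , x∈r₁ , refl = y∉P (r₁⊆P x∈r₁)

module Presentation {c} {A : Set c} (_∙_ : Op₂ A) (e : A) (isMonoid : IsMonoid _≡_ _∙_ e) where
  open IsMonoid isMonoid using () renaming (assoc to ∙-assoc; identityˡ to ∙-identityˡ; identityʳ to ∙-identityʳ)

  toWord : ∀ {n} → Term A n → Word A n
  toWord (var i) = [ (i , e) ]
  toWord u = []
  toWord (p α t) = recolour (α ∙_) (toWord t)
  toWord (star t s) = toWord t ++ toWord s

  recolour-identity : ∀ {n} (w : Word A n) → recolour (e ∙_) w ≡ w
  recolour-identity [] = refl
  recolour-identity ((i , α) ∷ w) = cong₂ _∷_ (cong (i ,_) (∙-identityˡ α)) (recolour-identity w)

  recolour-∙ : ∀ {n} α β (w : Word A n) → recolour (α ∙_) (recolour (β ∙_) w) ≡ recolour ((α ∙ β) ∙_) w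
  recolour-∙ α β [] = refl
  recolour-∙ α β ((i , γ) ∷ w) = cong₂ _∷_ (cong (i ,_) (sym (∙-assoc α β γ))) (recolour-∙ α β w)

  wsup-recolour : ∀ {k m} α (w : Word A k) (ps : Fin k → Word A m) →
                  wsup _∙_ (recolour (α ∙_) w) ps ≡ recolour (α ∙_) (wsup _∙_ w ps)
  wsup-recolour α [] ps = refl
  wsup-recolour α ((i , β) ∷ w) ps =
    trans (cong₂ _++_ (sym (recolour-∙ α β (ps i))) (wsup-recolour α w ps))
          (sym (map-++ _ (recolour (β ∙_) (ps i)) (wsup _∙_ w ps)))

  toWord-⟦⟧ : ∀ {k m} (t : Term A k) (σ : Fin k → Term A m) → toWord (t ⟦ σ ⟧) ≡ wsup _∙_ (toWord t) (toWord ∘ σ)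
  toWord-⟦⟧ (var i) σ = sym (trans (++-identityʳ _) (recolour-identity (toWord (σ i))))
  toWord-⟦⟧ u σ = refl
  toWord-⟦⟧ (p α t) σ = trans (cong (recolour (α ∙_)) (toWord-⟦⟧ t σ)) (sym (wsup-recolour α (toWord t) _))
  toWord-⟦⟧ (star t s) σ = trans (cong₂ _++_ (toWord-⟦⟧ t σ) (toWord-⟦⟧ s σ)) (sym (wsup-++ _∙_ (toWord t) (toWord s) _))

  toWord-rc : ∀ {n} (w : Word A n) → toWord (rc w) ≡ w
  toWord-rc [] = refl
  toWord-rc ((i , α) ∷ w) = cong₂ _∷_ (cong (i ,_) (∙-identityʳ α)) (toWord-rc w)

  infix 4 _≈_
  _≈_ : ∀ {n} → Term A n → Term A n → Set c
  t ≈ t′ = t ≡R'[ _∙_ , e ] t′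

  termSetoid : ℕ → Setoid c c
  termSetoid n = record
    { Carrier = Term A n
    ; _≈_ = _≈_
    ; isEquivalence = record { refl = CloneCong.refl ; sym = CloneCong.sym ; trans = CloneCong.trans }
    }

  module ≈-Reasoning {n} = SetoidReasoning (termSetoid n)

  toWord-sound-axiom : ∀ {k t t′} → R'M _∙_ e k t t′ → PillEq (toWord t) (toWord t′)
  toWord-sound-axiom (old assoc) = PillEq-refl
  toWord-sound-axiom (old unitl) = PillEq-refl
  toWord-sound-axiom (old unitr) = PillEq-refl
  toWord-sound-axiom (old (p-star α)) = PillEq-refl
  toWord-sound-axiom (old (p-u α)) = PillEq-refl
  toWord-sound-axiom (old (p-p α β)) = ≡⇒PillEq (cong (λ γ → [ (zero , γ) ]) (sym (∙-assoc α β e)))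
  toWord-sound-axiom (old p-e) = ≡⇒PillEq (cong (λ γ → [ (zero , γ) ]) (∙-identityˡ e))
  toWord-sound-axiom (eq3a α₁ α₂ α₃) = (↭.prep _ (↭.swap _ _ ↭.refl) , refl , refl)
  toWord-sound-axiom (eq3b α₁ α₂ α₃) = (↭.prep _ (↭.prep _ (↭.swap _ _ ↭.refl)) , refl , refl)
  toWord-sound-axiom (eq4 α₁ α₂ β₁ β₂) = (↭.prep _ (↭.prep _ (↭.swap _ _ ↭.refl)) , refl , refl)

  toWord-sound : ∀ {n} {t t′ : Term A n} → t ≈ t′ → PillEq (toWord t) (toWord t′)
  toWord-sound (ax r) = toWord-sound-axiom r
  toWord-sound CloneCong.refl = PillEq-refl
  toWord-sound (CloneCong.sym t≈t′) = PillEq-sym (toWord-sound t≈t′)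
  toWord-sound (CloneCong.trans t≈t′ t′≈t″) = PillEq-trans (toWord-sound t≈t′) (toWord-sound t′≈t″)
  toWord-sound (sup {t = t} {t′} {σ} {σ′} t≈t′ σ≈σ′) =
    subst₂ PillEq (sym (toWord-⟦⟧ t σ)) (sym (toWord-⟦⟧ t′ σ′)) (wsup-cong _∙_ (toWord-sound t≈t′) (toWord-sound ∘ σ≈σ′))

  instance-of : ∀ {k m t t′} → R'M _∙_ e k t t′ → (σ : Fin k → Term A m) → t ⟦ σ ⟧ ≈ t′ ⟦ σ ⟧
  instance-of r σ = sup (ax r) (λ _ → CloneCong.refl)

  star-cong : ∀ {n} {t t′ s s′ : Term A n} → t ≈ t′ → s ≈ s′ → star t s ≈ star t′ s′
  star-cong {t = t} {t′} {s} {s′} t≈t′ s≈s′ =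
    sup {k = 2} {t = star (var zero) (var (suc zero))} {σ = λ { zero → t ; (suc zero) → s }} {σ' = λ { zero → t′ ; (suc zero) → s′ }}
        CloneCong.refl (λ { zero → t≈t′ ; (suc zero) → s≈s′ })

  p-cong : ∀ {n} α {t t′ : Term A n} → t ≈ t′ → p α t ≈ p α t′
  p-cong α {t} {t′} t≈t′ = sup {k = 1} {t = p α (var zero)} {σ = λ _ → t} {σ' = λ _ → t′} CloneCong.refl (λ _ → t≈t′)

  p-rc : ∀ {n} α (w : Word A n) → p α (rc w) ≈ rc (recolour (α ∙_) w)
  p-rc α [] = instance-of (old (p-u α)) (λ ())
  p-rc α ((i , β) ∷ w) = CloneCong.trans
    (instance-of (old (p-star α)) (λ { zero → p β (var i) ; (suc zero) → rc w }))
    (star-cong (instance-of (old (p-p α β)) (λ _ → var i)) (p-rc α w))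

  star-rc : ∀ {n} (w₁ w₂ : Word A n) → star (rc w₁) (rc w₂) ≈ rc (w₁ ++ w₂)
  star-rc [] w₂ = instance-of (old unitl) (λ _ → rc w₂)
  star-rc ((i , β) ∷ w₁) w₂ = CloneCong.trans
    (instance-of (old assoc) (λ { zero → p β (var i) ; (suc zero) → rc w₁ ; (suc (suc zero)) → rc w₂ }))
    (star-cong CloneCong.refl (star-rc w₁ w₂))

  normalise : ∀ {n} (t : Term A n) → t ≈ rc (toWord t)
  normalise (var i) = CloneCong.trans (instance-of (old unitr) (λ _ → var i))
                                      (star-cong (CloneCong.sym (instance-of (old p-e) (λ _ → var i))) CloneCong.refl)
  normalise u = CloneCong.refl
  normalise (p α t) = CloneCong.trans (p-cong α (normalise t)) (p-rc α (toWord t))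
  normalise (star t s) = CloneCong.trans (star-cong (normalise t) (normalise s)) (star-rc (toWord t) (toWord s))

  rc-⟦⟧ : ∀ {k m} (w : Word A k) (z : Fin k → Word A m) → rc w ⟦ rc ∘ z ⟧ ≈ rc (wsup _∙_ w z)
  rc-⟦⟧ w z = begin
    rc w ⟦ rc ∘ z ⟧                                   ≈⟨ normalise (rc w ⟦ rc ∘ z ⟧) ⟩
    rc (toWord (rc w ⟦ rc ∘ z ⟧))                     ≡⟨ cong rc (toWord-⟦⟧ (rc w) (rc ∘ z)) ⟩
    rc (wsup _∙_ (toWord (rc w)) (toWord ∘ rc ∘ z))   ≡⟨ cong₂ (λ v zs → rc (wsup _∙_ v zs)) (toWord-rc w) refl ⟩
    rc (wsup _∙_ w (toWord ∘ rc ∘ z))                 ≡⟨ cong rc (wsup-≗ _∙_ w (toWord-rc ∘ z)) ⟩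
    rc (wsup _∙_ w z) ∎
    where open ≈-Reasoning

  axiom-wsup : ∀ {k m} {L R : Word A k} → R'M _∙_ e k (rc L) (rc R) → (z : Fin k → Word A m) →
               rc (wsup _∙_ L z) ≈ rc (wsup _∙_ R z)
  axiom-wsup {L = L} {R} r z = begin
    rc (wsup _∙_ L z)  ≈⟨ CloneCong.sym (rc-⟦⟧ L z) ⟩
    rc L ⟦ rc ∘ z ⟧    ≈⟨ instance-of r (rc ∘ z) ⟩
    rc R ⟦ rc ∘ z ⟧    ≈⟨ rc-⟦⟧ R z ⟩
    rc (wsup _∙_ R z) ∎
    where open ≈-Reasoning

  rc-++-cong : ∀ {n} (U : Word A n) {X X′} V → rc X ≈ rc X′ → rc (U ++ X ++ V) ≈ rc (U ++ X′ ++ V)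
  rc-++-cong U {X} {X′} V X≈X′ = begin
    rc (U ++ X ++ V)               ≈⟨ CloneCong.sym (star-rc U (X ++ V)) ⟩
    star (rc U) (rc (X ++ V))      ≈⟨ star-cong CloneCong.refl (CloneCong.sym (star-rc X V)) ⟩
    star (rc U) (star (rc X) (rc V))   ≈⟨ star-cong CloneCong.refl (star-cong X≈X′ CloneCong.refl) ⟩
    star (rc U) (star (rc X′) (rc V))  ≈⟨ star-cong CloneCong.refl (star-rc X′ V) ⟩
    star (rc U) (rc (X′ ++ V))     ≈⟨ star-rc U (X′ ++ V) ⟩
    rc (U ++ X′ ++ V) ∎
    where open ≈-Reasoning

  private
    σ₃ : ∀ {m} → Word A m → Word A m → Word A m → Fin 3 → Word A m
    σ₃ X Y Z zero = X
    σ₃ X Y Z (suc zero) = Y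
    σ₃ X Y Z (suc (suc zero)) = Z

    σ₄ : ∀ {m} → Word A m → Word A m → Word A m → Word A m → Fin 4 → Word A m
    σ₄ X Y Z W zero = X
    σ₄ X Y Z W (suc zero) = Y
    σ₄ X Y Z W (suc (suc zero)) = Z
    σ₄ X Y Z W (suc (suc (suc zero))) = W

  rc-pull-between : ∀ {m} (j : Fin m) a b d Z Y →
                    rc ((j , a) ∷ Z ++ (j , b) ∷ Y ++ [ (j , d) ]) ≈ rc ((j , a) ∷ (j , b) ∷ Z ++ Y ++ [ (j , d) ])
  rc-pull-between j a b d Z Y = begin
    rc ((j , a) ∷ Z ++ (j , b) ∷ Y ++ [ (j , d) ])   ≡⟨ cong rc (sym spreadS) ⟩
    rc (wsup _∙_ S σ)                                 ≈⟨ CloneCong.sym (axiom-wsup {L = G} {S} (eq3a a b d) σ) ⟩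
    rc (wsup _∙_ G σ)                                 ≡⟨ cong rc spreadG ⟩
    rc ((j , a) ∷ (j , b) ∷ Z ++ Y ++ [ (j , d) ]) ∎
    where
    open ≈-Reasoning
    G S : Word A 3
    G = (zero , a) ∷ (zero , b) ∷ (suc zero , e) ∷ (suc (suc zero) , e) ∷ (zero , d) ∷ []
    S = (zero , a) ∷ (suc zero , e) ∷ (zero , b) ∷ (suc (suc zero) , e) ∷ (zero , d) ∷ []
    σ = σ₃ [ (j , e) ] Z Y
    spreadS : wsup _∙_ S σ ≡ (j , a) ∷ Z ++ (j , b) ∷ Y ++ [ (j , d) ]
    spreadS rewrite ∙-identityʳ a | ∙-identityʳ b | ∙-identityʳ d | recolour-identity Z | recolour-identity Y = refl
    spreadG : wsup _∙_ G σ ≡ (j , a) ∷ (j , b) ∷ Z ++ Y ++ [ (j , d) ]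
    spreadG rewrite ∙-identityʳ a | ∙-identityʳ b | ∙-identityʳ d | recolour-identity Z | recolour-identity Y = refl

  rc-move-between : ∀ {m} (j : Fin m) a b d Z y Y →
                    rc ((j , a) ∷ Z ++ (j , b) ∷ y ∷ Y ++ [ (j , d) ]) ≈ rc ((j , a) ∷ Z ++ y ∷ (j , b) ∷ Y ++ [ (j , d) ])
  rc-move-between j a b d Z y Y = begin
    rc ((j , a) ∷ Z ++ (j , b) ∷ y ∷ Y ++ [ (j , d) ])       ≈⟨ rc-pull-between j a b d Z (y ∷ Y) ⟩
    rc ((j , a) ∷ (j , b) ∷ Z ++ y ∷ Y ++ [ (j , d) ])       ≡⟨ cong (λ V → rc ((j , a) ∷ (j , b) ∷ V)) (sym (++-assoc Z [ y ] _)) ⟩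
    rc ((j , a) ∷ (j , b) ∷ (Z ++ [ y ]) ++ Y ++ [ (j , d) ]) ≈⟨ CloneCong.sym (rc-pull-between j a b d (Z ++ [ y ]) Y) ⟩
    rc ((j , a) ∷ (Z ++ [ y ]) ++ (j , b) ∷ Y ++ [ (j , d) ]) ≡⟨ cong (λ V → rc ((j , a) ∷ V)) (++-assoc Z [ y ] _) ⟩
    rc ((j , a) ∷ Z ++ y ∷ (j , b) ∷ Y ++ [ (j , d) ]) ∎
    where open ≈-Reasoning

  rc-swap-crossing : ∀ {m} (j i : Fin m) a₁ a₂ b₁ b₂ Z Y →
                     rc ((j , a₁) ∷ Z ++ (i , b₁) ∷ (j , a₂) ∷ Y ++ [ (i , b₂) ]) ≈
                     rc ((j , a₁) ∷ Z ++ (j , a₂) ∷ (i , b₁) ∷ Y ++ [ (i , b₂) ])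
  rc-swap-crossing j i a₁ a₂ b₁ b₂ Z Y = begin
    rc ((j , a₁) ∷ Z ++ (i , b₁) ∷ (j , a₂) ∷ Y ++ [ (i , b₂) ])   ≡⟨ cong rc (sym spreadL) ⟩
    rc (wsup _∙_ L σ)                                               ≈⟨ axiom-wsup {L = L} {R} (eq4 a₁ a₂ b₁ b₂) σ ⟩
    rc (wsup _∙_ R σ)                                               ≡⟨ cong rc spreadR ⟩
    rc ((j , a₁) ∷ Z ++ (j , a₂) ∷ (i , b₁) ∷ Y ++ [ (i , b₂) ]) ∎
    where
    open ≈-Reasoning
    L R : Word A 4
    L = (zero , a₁) ∷ (suc zero , e) ∷ (suc (suc zero) , b₁) ∷ (zero , a₂) ∷ (suc (suc (suc zero)) , e) ∷ (suc (suc zero) , b₂) ∷ []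
    R = (zero , a₁) ∷ (suc zero , e) ∷ (zero , a₂) ∷ (suc (suc zero) , b₁) ∷ (suc (suc (suc zero)) , e) ∷ (suc (suc zero) , b₂) ∷ []
    σ = σ₄ [ (j , e) ] Z [ (i , e) ] Y
    spreadL : wsup _∙_ L σ ≡ (j , a₁) ∷ Z ++ (i , b₁) ∷ (j , a₂) ∷ Y ++ [ (i , b₂) ]
    spreadL rewrite ∙-identityʳ a₁ | ∙-identityʳ a₂ | ∙-identityʳ b₁ | ∙-identityʳ b₂ | recolour-identity Z | recolour-identity Y = refl
    spreadR : wsup _∙_ R σ ≡ (j , a₁) ∷ Z ++ (j , a₂) ∷ (i , b₁) ∷ Y ++ [ (i , b₂) ]
    spreadR rewrite ∙-identityʳ a₁ | ∙-identityʳ a₂ | ∙-identityʳ b₁ | ∙-identityʳ b₂ | recolour-identity Z | recolour-identity Y = refl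

  rc-swap-framed : ∀ {m} A₁ A₂ B₁ B₂ (l r x y : Letter A m) →
                   rc (l ∷ A₂ ++ x ∷ y ∷ B₁ ++ [ r ]) ≈ rc (l ∷ A₂ ++ y ∷ x ∷ B₁ ++ [ r ]) →
                   rc ((A₁ ++ l ∷ A₂) ++ x ∷ y ∷ B₁ ++ r ∷ B₂) ≈ rc ((A₁ ++ l ∷ A₂) ++ y ∷ x ∷ B₁ ++ r ∷ B₂)
  rc-swap-framed A₁ A₂ B₁ B₂ l r x y local = begin
    rc ((A₁ ++ l ∷ A₂) ++ x ∷ y ∷ B₁ ++ r ∷ B₂)        ≡⟨ cong rc (++-reframe A₁ A₂ B₁ B₂ l r x y) ⟩
    rc (A₁ ++ (l ∷ A₂ ++ x ∷ y ∷ B₁ ++ [ r ]) ++ B₂)   ≈⟨ rc-++-cong A₁ B₂ local ⟩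
    rc (A₁ ++ (l ∷ A₂ ++ y ∷ x ∷ B₁ ++ [ r ]) ++ B₂)   ≡⟨ cong rc (sym (++-reframe A₁ A₂ B₁ B₂ l r y x)) ⟩
    rc ((A₁ ++ l ∷ A₂) ++ y ∷ x ∷ B₁ ++ r ∷ B₂) ∎
    where open ≈-Reasoning

  rc-swap : ∀ {m} (P Q : Word A m) (x y : Letter A m) →
            proj₁ x ∈ vals P ⊎ proj₁ y ∈ vals P → proj₁ x ∈ vals Q ⊎ proj₁ y ∈ vals Q →
            rc (P ++ x ∷ y ∷ Q) ≈ rc (P ++ y ∷ x ∷ Q)
  rc-swap P Q (i , b) y (inj₁ x∈P) (inj₁ x∈Q) with split-at-value P x∈P | split-at-value Q x∈Q
  ... | A₁ , A₂ , a , refl | B₁ , B₂ , d , refl = rc-swap-framed A₁ A₂ B₁ B₂ _ _ _ _ (rc-move-between i a b d A₂ y B₁)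
  rc-swap P Q (i , b₁) (j , a₂) (inj₂ y∈P) (inj₁ x∈Q) with split-at-value P y∈P | split-at-value Q x∈Q
  ... | A₁ , A₂ , a₁ , refl | B₁ , B₂ , b₂ , refl = rc-swap-framed A₁ A₂ B₁ B₂ _ _ _ _ (rc-swap-crossing j i a₁ a₂ b₁ b₂ A₂ B₁)
  rc-swap P Q x y (inj₂ y∈P) (inj₂ y∈Q) = CloneCong.sym (rc-swap P Q y x (inj₁ y∈P) (inj₁ y∈Q))
  rc-swap P Q x y (inj₁ x∈P) (inj₂ y∈Q) = CloneCong.sym (rc-swap P Q y x (inj₂ x∈P) (inj₁ y∈Q))

  rc-bubble : ∀ {m} (P r₁ r₂ : Word A m) y → LeftSeen P r₁ y → RightSeen r₁ y r₂ →
              rc (P ++ r₁ ++ y ∷ r₂) ≈ rc (P ++ y ∷ r₁ ++ r₂)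
  rc-bubble P [] r₂ y _ _ = CloneCong.refl
  rc-bubble P (x ∷ r₁) r₂ y ls (rs-x , rs) = begin
    rc (P ++ x ∷ r₁ ++ y ∷ r₂)      ≡⟨ cong rc (sym (++-assoc P [ x ] _)) ⟩
    rc ((P ++ [ x ]) ++ r₁ ++ y ∷ r₂) ≈⟨ rc-bubble (P ++ [ x ]) r₁ r₂ y ls′ rs ⟩
    rc ((P ++ [ x ]) ++ y ∷ r₁ ++ r₂) ≡⟨ cong rc (++-assoc P [ x ] _) ⟩
    rc (P ++ x ∷ y ∷ r₁ ++ r₂)      ≈⟨ rc-swap P (r₁ ++ r₂) x y (ls (here refl)) rs-x ⟩
    rc (P ++ y ∷ x ∷ r₁ ++ r₂) ∎
    where
    open ≈-Reasoning
    ls′ : LeftSeen (P ++ [ x ]) r₁ y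
    ls′ x′∈r₁ = Data.Sum.map (∈-vals-++⁺ˡ P) (∈-vals-++⁺ˡ P) (ls (there x′∈r₁))

  rc-complete-from : ∀ {m} (P r r′ : Word A m) → PillEq (P ++ r) (P ++ r′) → rc (P ++ r) ≈ rc (P ++ r′)
  rc-complete-from P r [] Pr≈P with ↭-empty-inv (proj₁ (PillEq-cancelˡ P Pr≈P))
  ... | refl = CloneCong.refl
  rc-complete-from P r (y ∷ s) Pr≈Pys with crossing-split P r y s Pr≈Pys
  ... | r₁ , r₂ , refl , ls , rs = begin
    rc (P ++ r₁ ++ y ∷ r₂)         ≈⟨ bubbled ⟩
    rc (P ++ y ∷ r₁ ++ r₂)         ≡⟨ cong rc (reassoc (r₁ ++ r₂)) ⟩
    rc ((P ++ [ y ]) ++ r₁ ++ r₂)  ≈⟨ rc-complete-from (P ++ [ y ]) (r₁ ++ r₂) s rest-equivalent ⟩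
    rc ((P ++ [ y ]) ++ s)         ≡⟨ cong rc (sym (reassoc s)) ⟩
    rc (P ++ y ∷ s) ∎
    where
    open ≈-Reasoning
    bubbled = rc-bubble P r₁ r₂ y ls rs
    reassoc : ∀ X → P ++ y ∷ X ≡ (P ++ [ y ]) ++ X
    reassoc X = sym (++-assoc P [ y ] X)
    rest-equivalent : PillEq ((P ++ [ y ]) ++ r₁ ++ r₂) ((P ++ [ y ]) ++ s)
    rest-equivalent = subst₂ PillEq (reassoc _) (reassoc _)
      (PillEq-trans (PillEq-sym (subst₂ PillEq (toWord-rc _) (toWord-rc _) (toWord-sound bubbled))) Pr≈Pys)

  toWord-complete : ∀ {n} (t t′ : Term A n) → PillEq (toWord t) (toWord t′) → t ≈ t′
  toWord-complete t t′ t≈t′ = begin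
    t                 ≈⟨ normalise t ⟩
    rc (toWord t)     ≈⟨ rc-complete-from [] (toWord t) (toWord t′) t≈t′ ⟩
    rc (toWord t′)    ≈⟨ CloneCong.sym (normalise t′) ⟩
    t′ ∎
    where open ≈-Reasoning

theorem5p3p8 : ∀ {c} (A : Set c) (_∙_ : Op₂ A) (e : A) → IsMonoid _≡_ _∙_ e →
    Σ (∀ {n} → Term A n → Word A n) λ φ →
      (∀ {n} (i : Fin n) → PillEq (φ (var i)) ((i , e) ∷ []))
      × (∀ {k n} (t : Term A k) (σ : Fin k → Term A n) →
           PillEq (φ (t ⟦ σ ⟧)) (wsup _∙_ (φ t) (λ i → φ (σ i))))
      × (∀ {n} (t t' : Term A n) → (t ≡R'[ _∙_ , e ] t') ⇔ PillEq (φ t) (φ t'))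
      × (∀ {n} (w : Word A n) → ∃ λ t → PillEq (φ t) w)
theorem5p3p8 A _∙_ e isMonoid =
  toWord ,
  (λ i → PillEq-refl) ,
  (λ t σ → ≡⇒PillEq (toWord-⟦⟧ t σ)) ,
  (λ t t′ → mk⇔ toWord-sound (toWord-complete t t′)) ,
  (λ w → rc w , ≡⇒PillEq (toWord-rc w))
  where open Presentation _∙_ e isMonoid
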